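{- Let $q$ be a prime power, $m \ge 2$, $g = \gcd(q-1, m(m-1))$, and $\lambda$ a partition of $m$ such that $S_{\lambda,\mathbb{F}_q}$ is nonempty. If $\delta_1, \delta_2 \in D_{\lambda,\mathbb{F}_q}$ and $\delta_2/\delta_1$ is a $g$th power in $\mathbb{F}_q^\times$, then the number of polynomials in $S_{\lambda,\mathbb{F}_q}$ with discriminant $\delta_1$ equals the number of polynomials in $S_{\lambda,\mathbb{F}_q}$ with discriminant $\delta_2$.
   Context: For a partition $\lambda=(\lambda_1,\dots,\lambda_k)$ of $m$ and a field $K$, a monic $f \in K[x]$ has factorization type $\lambda$ if $f = \pi_1\cdots\pi_k$ with $\pi_i$ distinct monic irreducible polynomials in $K[x]$ and $\deg \pi_i = \lambda_i$. $S_{\lambda,K}$ is the set of monic squarefree $f \in K[x]$ of factorization type $\lambda$, and $D_{\lambda,K} = \{\operatorname{disc}(f) : f \in S_{\lambda,K}\}$. The discriminant of $f$ of degree $m\ge 2$ with leading coefficient $a_m$ and roots $\alpha_i$ is $a_m^{2m-2}\prod_{i<j}(\alpha_i-\alpha_j)^2$. -}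

module Defs where

open import Level using (0ℓ; Lift)
import Level
open import Data.Nat as ℕ using (ℕ; zero; suc; _≥_; _∸_)
open import Data.Nat.GCD using (gcd)
open import Data.Nat.ListAction using (sum)
open import Data.Product using (Σ; ∃; ∃-syntax; _×_; _,_; proj₁)
open import Data.List as List using (List; []; _∷_; _++_; length; foldr)
open import Data.List.Relation.Unary.All using (All)
open import Data.List.Relation.Unary.Unique.Propositional using (Unique)
open import Data.List.Relation.Unary.Linked using (Linked)
open import Data.List.Membership.Propositional using (_∈_)
open import Data.Vec as Vec using (Vec)
open import Relation.Binary.PropositionalEquality using (_≡_; _≢_)
open import Relation.Nullary using (¬_)
open import Algebra.Structures using (IsCommutativeRing)

record Field : Set₁ where
  infixl 7 _*_
  infixl 6 _+_
  field
    Carrier : Set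
    _+_ _*_ : Carrier → Carrier → Carrier
    -_      : Carrier → Carrier
    0# 1#   : Carrier
    isCommutativeRing : IsCommutativeRing _≡_ _+_ _*_ -_ 0# 1#
    0≢1     : 0# ≢ 1#
    inverse : ∀ x → x ≢ 0# → ∃[ y ] (x * y ≡ 1#)

  _-_ : Carrier → Carrier → Carrier
  x - y = x + (- y)

  _^_ : Carrier → ℕ → Carrier
  x ^ zero  = 1#
  x ^ suc n = x * (x ^ n)

  -- Polynomials as coefficient lists, lowest degree first.
  Poly : Set
  Poly = List Carrier

  _+ₚ_ : Poly → Poly → Poly
  [] +ₚ q = q
  (a ∷ p) +ₚ [] = a ∷ p
  (a ∷ p) +ₚ (b ∷ q) = (a + b) ∷ (p +ₚ q)

  _*ₚ_ : Poly → Poly → Poly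
  [] *ₚ q = []
  (a ∷ p) *ₚ q = List.map (a *_) q +ₚ (0# ∷ (p *ₚ q))

  prodₚ : List Poly → Poly
  prodₚ = foldr _*ₚ_ (1# ∷ [])

  -- A monic polynomial of degree d is given by its d lower coefficients
  -- (coefficients of x^0, ..., x^(d-1)); its leading coefficient is 1.
  toPoly : ∀ {d} → Vec Carrier d → Poly
  toPoly v = Vec.toList v ++ (1# ∷ [])

  Monic : Set
  Monic = Σ ℕ (Vec Carrier)

  -- Irreducible in K[x]: positive degree and not a product of two
  -- polynomials of positive degree (units of K[x] are the nonzero
  -- constants, so any factorisation can be normalised to monic factors).
  Irreducible : Monic → Set
  Irreducible (d , π) =
    d ≥ 1 ×
    ¬ (∃[ a ] ∃[ b ] (a ≥ 1 × b ≥ 1 ×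
        Σ (Vec Carrier a) λ u → Σ (Vec Carrier b) λ w →
          toPoly u *ₚ toPoly w ≡ toPoly π))

  HasFactorizationType : ∀ {m} → List ℕ → Vec Carrier m → Set
  HasFactorizationType λs f =
    Σ (List Monic) λ πs →
      List.map proj₁ πs ≡ λs ×
      All Irreducible πs ×
      Unique πs ×
      prodₚ (List.map (λ π → toPoly (proj₂' π)) πs) ≡ toPoly f
    where
    proj₂' : (π : Monic) → Vec Carrier (proj₁ π)
    proj₂' (_ , v) = v

record IsFieldHom (K L : Field) (φ : Field.Carrier K → Field.Carrier L) : Set where
  private
    module K = Field K
    module L = Field L
  field
    +-homo : ∀ x y → φ (x K.+ y) ≡ φ x L.+ φ y
    *-homo : ∀ x y → φ (x K.* y) ≡ φ x L.* φ y
    0-homo : φ K.0# ≡ L.0#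
    1-homo : φ K.1# ≡ L.1#

module _ (L : Field) where
  open Field L

  rootDiscProd : List Carrier → Carrier
  rootDiscProd [] = 1#
  rootDiscProd (a ∷ as) =
    foldr (λ b r → ((a - b) ^ 2) * r) 1# as * rootDiscProd as

  linearProd : List Carrier → Poly
  linearProd αs = prodₚ (List.map (λ a → (- a) ∷ 1# ∷ []) αs)

-- IsDisc K f δ : δ is the discriminant of the monic f of degree m, i.e. in
-- some extension field L ⊇ K over which f splits as ∏(x - αᵢ), the image of
-- δ equals ∏_{i<j}(αᵢ - αⱼ)² (the leading coefficient is 1).
IsDisc : (K : Field) → ∀ {m} → Vec (Field.Carrier K) m → Field.Carrier K → Set₁
IsDisc K {m} f δ =
  Σ Field λ L → Σ (Field.Carrier K → Field.Carrier L) λ φ →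
    IsFieldHom K L φ ×
    Σ (Vec (Field.Carrier L) m) λ αs →
      List.map φ (Field.toPoly K f) ≡ linearProd L (Vec.toList αs) ×
      φ δ ≡ rootDiscProd L (Vec.toList αs)

record FiniteField : Set₁ where
  field
    field′   : Field
  open Field field′
  field
    elements : List Carrier
    complete : ∀ x → x ∈ elements
    distinct : Unique elements

  size : ℕ
  size = length elements

IsPartition : ℕ → List ℕ → Set
IsPartition m λs = All (_≥ 1) λs × Linked _≥_ λs × sum λs ≡ m

HasCount : ∀ {A : Set} → (A → Set₁) → ℕ → Set₁
HasCount {A} P n =
  Σ (List A) λ l → length l ≡ n × Unique l ×
    (∀ x → (x ∈ l → P x) × (P x → x ∈ l))

module _ (K : Field) where
  open Field K

  InSWithDisc : (m : ℕ) → List ℕ → Carrier → Vec Carrier m → Set₁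
  InSWithDisc m λs δ f = Lift′ (HasFactorizationType λs f) × IsDisc K f δ
    where
    Lift′ : Set → Set₁
    Lift′ X = Lift (Level.suc 0ℓ) X

  InD : ℕ → List ℕ → Carrier → Set₁
  InD m λs δ = Σ (Vec Carrier m) λ f → InSWithDisc m λs δ f

  SNonempty : ℕ → List ℕ → Set
  SNonempty m λs = Σ (Vec Carrier m) λ f → HasFactorizationType λs f

-- For a unit u, the rescaling f(x) ↦ u^m f(x/u) of a monic f of
-- degree m is a bijection on monic polynomials of degree m (inverse: rescale
-- by u⁻¹).  It is multiplicative, so it maps irreducible factors to
-- irreducible factors of the same degrees and preserves the factorization
-- type; and it multiplies every root by u, so it multiplies the discriminant
-- by u^(m(m-1)).  Hence the polynomials of type λ with discriminant δ and
-- with discriminant u^(m(m-1))·δ are equinumerous.  Finally, c^g is always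
-- of the form u^(m(m-1)): by Fermat c^(q-1) = 1, and g is an integer
-- combination of q-1 and m(m-1) (Bézout).

module Submission where

open import Defs
open import Level using (0ℓ; lift)
open import Algebra.Bundles using (CommutativeRing)
open import Data.Nat as ℕ using (ℕ; zero; suc; _≥_; _∸_; _≤_; s≤s)
import Data.Nat.Properties as ℕP
open import Data.List as List using (List; []; _∷_; length; foldr)
import Data.List.Properties as LP
open import Data.List.Relation.Unary.All as All using (All; []; _∷_)
import Data.List.Relation.Unary.All.Properties as AllP
import Data.List.Relation.Unary.Unique.Propositional.Properties as UP
open import Data.Vec as Vec using (Vec; []; _∷_)
import Data.Vec.Properties as VP
open import Data.Product using (Σ; _×_; _,_; proj₁; proj₂)
open import Function using (_∘_)
open import Data.List.Membership.Propositional using (_∈_)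
import Data.List.Membership.Propositional.Properties as MP
open import Data.List.Membership.Propositional.Properties.WithK using (unique∧set⇒bag)
open import Data.List.Relation.Binary.BagAndSetEquality using (∼bag⇒↭)
open import Data.List.Relation.Binary.Permutation.Propositional using (_↭_; ↭⇒↭ₛ)
import Data.List.Relation.Binary.Permutation.Propositional.Properties as PP
open import Data.List.Relation.Unary.Any using (here; there)
open import Data.List.Relation.Unary.Unique.Propositional using (Unique; _∷_)
open import Data.Empty using (⊥-elim)
open import Function.Bundles using (mk⇔)
open import Data.Nat.GCD using (gcd; gcd-GCD; module Bézout)
open import Relation.Binary.PropositionalEquality
import Data.List.Relation.Binary.Permutation.Setoid.Properties
open import Data.Nat.Tactic.RingSolver using (solve-∀)

module FieldAlgebra (K : Field) where
  open Field K

  commutativeRing : CommutativeRing 0ℓ 0ℓ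
  commutativeRing = record { isCommutativeRing = isCommutativeRing }

  open CommutativeRing commutativeRing public
    using (*-comm; *-assoc; *-identityˡ; *-identityʳ; zeroʳ; distribˡ; *-isCommutativeMonoid)
  open import Algebra.Properties.CommutativeSemigroup
    (CommutativeRing.*-commutativeSemigroup commutativeRing) public
    using (interchange; x∙yz≈y∙xz)
  open import Algebra.Properties.Ring (CommutativeRing.ring commutativeRing) public
    using (-‿distribʳ-*; x[y-z]≈xy-xz)

  ^-+ : ∀ x a b → x ^ (a ℕ.+ b) ≡ x ^ a * x ^ b
  ^-+ x zero    b = sym (*-identityˡ _)
  ^-+ x (suc a) b = trans (cong (x *_) (^-+ x a b)) (sym (*-assoc x _ _))

  ^-* : ∀ x a b → x ^ (a ℕ.* b) ≡ (x ^ b) ^ a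
  ^-* x zero    b = refl
  ^-* x (suc a) b = trans (^-+ x b (a ℕ.* b)) (cong (x ^ b *_) (^-* x a b))

  *-^ : ∀ x y n → (x * y) ^ n ≡ x ^ n * y ^ n
  *-^ x y zero    = sym (*-identityˡ 1#)
  *-^ x y (suc n) = trans (cong ((x * y) *_) (*-^ x y n)) (interchange x y (x ^ n) (y ^ n))

  1^ : ∀ n → 1# ^ n ≡ 1#
  1^ zero    = refl
  1^ (suc n) = trans (cong (1# *_) (1^ n)) (*-identityˡ 1#)

  record Unit : Set where
    field
      val inv : Carrier
      val*inv : val * inv ≡ 1#
  open Unit public

  _⁻¹ᵘ : Unit → Unit
  u ⁻¹ᵘ = record { val = inv u ; inv = val u ; val*inv = trans (*-comm _ _) (val*inv u) }

  _^ᵘ_ : Unit → ℕ → Unit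
  u ^ᵘ n = record
    { val = val u ^ n ; inv = inv u ^ n
    ; val*inv = trans (sym (*-^ (val u) (inv u) n)) (trans (cong (_^ n) (val*inv u)) (1^ n)) }

  unitOf : ∀ c → c ≢ 0# → Unit
  unitOf c c≢0 = record { val = c ; inv = proj₁ (inverse c c≢0) ; val*inv = proj₂ (inverse c c≢0) }

  inv-cancel : (u : Unit) → ∀ x → inv u * (val u * x) ≡ x
  inv-cancel u x = begin
    inv u * (val u * x) ≡⟨ sym (*-assoc _ _ x) ⟩
    (inv u * val u) * x ≡⟨ cong (_* x) (val*inv (u ⁻¹ᵘ)) ⟩
    1# * x              ≡⟨ *-identityˡ x ⟩
    x                   ∎
    where open ≡-Reasoning

  nonzero-* : ∀ {x y} → x ≢ 0# → y ≢ 0# → x * y ≢ 0#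
  nonzero-* {x} {y} x≢0 y≢0 xy≡0 = y≢0 (begin
    y                  ≡⟨ sym (inv-cancel (unitOf x x≢0) y) ⟩
    inv′ * (x * y)     ≡⟨ cong (inv′ *_) xy≡0 ⟩
    inv′ * 0#          ≡⟨ zeroʳ inv′ ⟩
    0#                 ∎)
    where
    open ≡-Reasoning
    inv′ : Carrier
    inv′ = inv (unitOf x x≢0)

  cancel-nonzero : ∀ {a p} → p ≢ 0# → a * p ≡ p → a ≡ 1#
  cancel-nonzero {a} {p} p≢0 ap≡p = begin
    a                  ≡⟨ sym (*-identityʳ a) ⟩
    a * 1#             ≡⟨ cong (a *_) (sym (val*inv pᵘ)) ⟩
    a * (p * inv pᵘ)   ≡⟨ sym (*-assoc a p _) ⟩
    (a * p) * inv pᵘ   ≡⟨ cong (_* inv pᵘ) ap≡p ⟩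
    p * inv pᵘ         ≡⟨ val*inv pᵘ ⟩
    1#                 ∎
    where
    open ≡-Reasoning
    pᵘ : Unit
    pᵘ = unitOf p p≢0

module Rescaling (K : Field) where
  open Field K
  open FieldAlgebra K
  open ≡-Reasoning

  infixr 7 _⊙_

  _⊙_ : Carrier → Poly → Poly
  c ⊙ p = List.map (c *_) p

  -- Substitution x ↦ v·x, i.e. σ v p = p(v x).
  σ : Carrier → Poly → Poly
  σ v []      = []
  σ v (a ∷ p) = a ∷ (v ⊙ σ v p)

  ⊙-+ₚ : ∀ c p q → c ⊙ (p +ₚ q) ≡ (c ⊙ p) +ₚ (c ⊙ q)
  ⊙-+ₚ c []      q       = refl
  ⊙-+ₚ c (a ∷ p) []      = refl
  ⊙-+ₚ c (a ∷ p) (b ∷ q) = cong₂ _∷_ (distribˡ c a b) (⊙-+ₚ c p q)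

  ⊙-⊙ : ∀ c d p → c ⊙ (d ⊙ p) ≡ (c * d) ⊙ p
  ⊙-⊙ c d []      = refl
  ⊙-⊙ c d (a ∷ p) = cong₂ _∷_ (sym (*-assoc c d a)) (⊙-⊙ c d p)

  ⊙-comm : ∀ c d p → c ⊙ (d ⊙ p) ≡ d ⊙ (c ⊙ p)
  ⊙-comm c d []      = refl
  ⊙-comm c d (a ∷ p) = cong₂ _∷_ (x∙yz≈y∙xz c d a) (⊙-comm c d p)

  ⊙-*ₚˡ : ∀ c p q → (c ⊙ p) *ₚ q ≡ c ⊙ (p *ₚ q)
  ⊙-*ₚˡ c []      q = refl
  ⊙-*ₚˡ c (a ∷ p) q = begin
    ((c * a) ⊙ q) +ₚ (0# ∷ ((c ⊙ p) *ₚ q))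
      ≡⟨ cong₂ _+ₚ_ (sym (⊙-⊙ c a q)) (cong₂ _∷_ (sym (zeroʳ c)) (⊙-*ₚˡ c p q)) ⟩
    (c ⊙ (a ⊙ q)) +ₚ (c ⊙ (0# ∷ (p *ₚ q)))
      ≡⟨ sym (⊙-+ₚ c (a ⊙ q) (0# ∷ (p *ₚ q))) ⟩
    c ⊙ ((a ⊙ q) +ₚ (0# ∷ (p *ₚ q))) ∎

  ⊙-*ₚʳ : ∀ c p q → p *ₚ (c ⊙ q) ≡ c ⊙ (p *ₚ q)
  ⊙-*ₚʳ c []      q = refl
  ⊙-*ₚʳ c (a ∷ p) q = begin
    (a ⊙ (c ⊙ q)) +ₚ (0# ∷ (p *ₚ (c ⊙ q)))
      ≡⟨ cong₂ _+ₚ_ (⊙-comm a c q) (cong₂ _∷_ (sym (zeroʳ c)) (⊙-*ₚʳ c p q)) ⟩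
    (c ⊙ (a ⊙ q)) +ₚ (c ⊙ (0# ∷ (p *ₚ q)))
      ≡⟨ sym (⊙-+ₚ c (a ⊙ q) (0# ∷ (p *ₚ q))) ⟩
    c ⊙ ((a ⊙ q) +ₚ (0# ∷ (p *ₚ q))) ∎

  σ-+ₚ : ∀ v p q → σ v (p +ₚ q) ≡ σ v p +ₚ σ v q
  σ-+ₚ v []      q       = refl
  σ-+ₚ v (a ∷ p) []      = refl
  σ-+ₚ v (a ∷ p) (b ∷ q) =
    cong ((a + b) ∷_) (trans (cong (v ⊙_) (σ-+ₚ v p q)) (⊙-+ₚ v (σ v p) (σ v q)))

  σ-⊙ : ∀ v c p → σ v (c ⊙ p) ≡ c ⊙ σ v p
  σ-⊙ v c []      = refl
  σ-⊙ v c (a ∷ p) = cong ((c * a) ∷_) (trans (cong (v ⊙_) (σ-⊙ v c p)) (⊙-comm v c (σ v p)))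

  σ-*ₚ : ∀ v p q → σ v (p *ₚ q) ≡ σ v p *ₚ σ v q
  σ-*ₚ v []      q = refl
  σ-*ₚ v (a ∷ p) q = begin
    σ v ((a ⊙ q) +ₚ (0# ∷ (p *ₚ q)))
      ≡⟨ σ-+ₚ v (a ⊙ q) (0# ∷ (p *ₚ q)) ⟩
    σ v (a ⊙ q) +ₚ (0# ∷ (v ⊙ σ v (p *ₚ q)))
      ≡⟨ cong₂ _+ₚ_ (σ-⊙ v a q) (cong (λ r → 0# ∷ (v ⊙ r)) (σ-*ₚ v p q)) ⟩
    (a ⊙ σ v q) +ₚ (0# ∷ (v ⊙ (σ v p *ₚ σ v q)))
      ≡⟨ cong (λ r → (a ⊙ σ v q) +ₚ (0# ∷ r)) (sym (⊙-*ₚˡ v (σ v p) (σ v q))) ⟩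
    (a ⊙ σ v q) +ₚ (0# ∷ ((v ⊙ σ v p) *ₚ σ v q)) ∎

  -- Nonempty coefficient lists (polynomials with a leading term); for these
  -- the number of coefficients of a product is additive up to one.
  data NonEmpty : Poly → Set where
    nonEmpty : ∀ {a p} → NonEmpty (a ∷ p)

  +ₚ-length : ∀ p q → length p ≤ length q → length (p +ₚ q) ≡ length q
  +ₚ-length []      q       _         = refl
  +ₚ-length (a ∷ p) (b ∷ q) (s≤s p≤q) = cong suc (+ₚ-length p q p≤q)

  +ₚ-identityʳ : ∀ p → p +ₚ [] ≡ p
  +ₚ-identityʳ []      = refl
  +ₚ-identityʳ (a ∷ p) = refl

  *ₚ-length : ∀ a p b q → length ((a ∷ p) *ₚ (b ∷ q)) ≡ suc (length p ℕ.+ length q)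
  *ₚ-length a []       b q = cong suc (trans (cong length (+ₚ-identityʳ (a ⊙ q))) (LP.length-map (a *_) q))
  *ₚ-length a (a′ ∷ p) b q = cong suc (begin
    length ((a ⊙ q) +ₚ ((a′ ∷ p) *ₚ (b ∷ q)))
      ≡⟨ +ₚ-length (a ⊙ q) _ (subst₂ _≤_ (sym (LP.length-map (a *_) q)) (sym (*ₚ-length a′ p b q))
                                (ℕP.m≤n⇒m≤1+n (ℕP.m≤n+m (length q) (length p)))) ⟩
    length ((a′ ∷ p) *ₚ (b ∷ q))
      ≡⟨ *ₚ-length a′ p b q ⟩
    suc (length p ℕ.+ length q) ∎)

  *ₚ-nonEmpty : ∀ {p q} → NonEmpty p → NonEmpty q → NonEmpty (p *ₚ q)
  *ₚ-nonEmpty nonEmpty nonEmpty = nonEmpty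

  prodₚ-nonEmpty : ∀ {ps} → All NonEmpty ps → NonEmpty (prodₚ ps)
  prodₚ-nonEmpty []         = nonEmpty
  prodₚ-nonEmpty (p ∷ ne)   = *ₚ-nonEmpty p (prodₚ-nonEmpty ne)

  rescale : Unit → Poly → Poly
  rescale u p = (val u ^ (length p ∸ 1)) ⊙ σ (inv u) p

  -- Rescaling is multiplicative: degrees add and substitution is a ring map.
  rescale-*ₚ : ∀ u {p q} → NonEmpty p → NonEmpty q → rescale u (p *ₚ q) ≡ rescale u p *ₚ rescale u q
  rescale-*ₚ u {a ∷ p} {b ∷ q} nonEmpty nonEmpty = begin
    (v ^ (length ((a ∷ p) *ₚ (b ∷ q)) ∸ 1)) ⊙ σ w ((a ∷ p) *ₚ (b ∷ q))
      ≡⟨ cong₂ (λ n r → (v ^ (n ∸ 1)) ⊙ r) (*ₚ-length a p b q) (σ-*ₚ w (a ∷ p) (b ∷ q)) ⟩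
    (v ^ (length p ℕ.+ length q)) ⊙ (σ w (a ∷ p) *ₚ σ w (b ∷ q))
      ≡⟨ cong (_⊙ (σ w (a ∷ p) *ₚ σ w (b ∷ q))) (^-+ v (length p) (length q)) ⟩
    (v ^ length p * v ^ length q) ⊙ (σ w (a ∷ p) *ₚ σ w (b ∷ q))
      ≡⟨ sym (⊙-⊙ (v ^ length p) (v ^ length q) _) ⟩
    (v ^ length p) ⊙ ((v ^ length q) ⊙ (σ w (a ∷ p) *ₚ σ w (b ∷ q)))
      ≡⟨ cong ((v ^ length p) ⊙_) (sym (⊙-*ₚʳ (v ^ length q) (σ w (a ∷ p)) (σ w (b ∷ q)))) ⟩
    (v ^ length p) ⊙ (σ w (a ∷ p) *ₚ ((v ^ length q) ⊙ σ w (b ∷ q)))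
      ≡⟨ sym (⊙-*ₚˡ (v ^ length p) (σ w (a ∷ p)) ((v ^ length q) ⊙ σ w (b ∷ q))) ⟩
    ((v ^ length p) ⊙ σ w (a ∷ p)) *ₚ ((v ^ length q) ⊙ σ w (b ∷ q)) ∎
    where
    v w : Carrier
    v = val u
    w = inv u

  rescale-prodₚ : ∀ u {ps} → All NonEmpty ps → rescale u (prodₚ ps) ≡ prodₚ (List.map (rescale u) ps)
  rescale-prodₚ u []                = cong (_∷ []) (*-identityˡ 1#)
  rescale-prodₚ u {p ∷ ps} (ne ∷ nes) = begin
    rescale u (p *ₚ prodₚ ps)               ≡⟨ rescale-*ₚ u ne (prodₚ-nonEmpty nes) ⟩
    rescale u p *ₚ rescale u (prodₚ ps)     ≡⟨ cong (rescale u p *ₚ_) (rescale-prodₚ u nes) ⟩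
    rescale u p *ₚ prodₚ (List.map (rescale u) ps) ∎

  -- On a monic polynomial of degree d, given by its lower coefficients
  -- (a₀, …, a_{d-1}), rescaling by u multiplies aᵢ by u^(d-i).
  rescaleMonic : ∀ {d} → Carrier → Vec Carrier d → Vec Carrier d
  rescaleMonic         c []      = []
  rescaleMonic {suc d} c (a ∷ f) = (c ^ suc d * a) ∷ rescaleMonic c f

  toPoly-nonEmpty : ∀ {d} (f : Vec Carrier d) → NonEmpty (toPoly f)
  toPoly-nonEmpty []      = nonEmpty
  toPoly-nonEmpty (a ∷ f) = nonEmpty

  toPoly-length : ∀ {d} (f : Vec Carrier d) → length (toPoly f) ≡ suc d
  toPoly-length []      = refl
  toPoly-length (a ∷ f) = cong suc (toPoly-length f)

  rescale-toPoly : ∀ u {d} (f : Vec Carrier d) → rescale u (toPoly f) ≡ toPoly (rescaleMonic (val u) f)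
  rescale-toPoly u []              = cong (_∷ []) (*-identityˡ 1#)
  rescale-toPoly u {suc d} (a ∷ f) =
    cong₂ (λ n r → (val u ^ n * a) ∷ r) (toPoly-length f) higher
    where
    -- u^(d+1) · u⁻¹ = u^d, so the higher coefficients are those of the
    -- rescaled tail.
    higher : (val u ^ length (toPoly f)) ⊙ (inv u ⊙ σ (inv u) (toPoly f)) ≡ toPoly (rescaleMonic (val u) f)
    higher = begin
      (val u ^ length (toPoly f)) ⊙ (inv u ⊙ σ (inv u) (toPoly f))
        ≡⟨ ⊙-⊙ _ (inv u) _ ⟩
      (val u ^ length (toPoly f) * inv u) ⊙ σ (inv u) (toPoly f)
        ≡⟨ cong (λ n → (val u ^ n * inv u) ⊙ σ (inv u) (toPoly f)) (toPoly-length f) ⟩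
      (val u * val u ^ d * inv u) ⊙ σ (inv u) (toPoly f)
        ≡⟨ cong (_⊙ σ (inv u) (toPoly f)) (trans (*-comm _ (inv u)) (inv-cancel u (val u ^ d))) ⟩
      (val u ^ d) ⊙ σ (inv u) (toPoly f)
        ≡⟨ cong (λ n → (val u ^ (n ∸ 1)) ⊙ σ (inv u) (toPoly f)) (sym (toPoly-length f)) ⟩
      rescale u (toPoly f)
        ≡⟨ rescale-toPoly u f ⟩
      toPoly (rescaleMonic (val u) f) ∎

  rescaleMonic-inverse : ∀ u {d} (f : Vec Carrier d) → rescaleMonic (inv u) (rescaleMonic (val u) f) ≡ f
  rescaleMonic-inverse u         []      = refl
  rescaleMonic-inverse u {suc d} (a ∷ f) = cong₂ _∷_ (inv-cancel (u ^ᵘ suc d) a) (rescaleMonic-inverse u f)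

module FactorizationType (K : Field) where
  open Field K
  open FieldAlgebra K
  open Rescaling K
  open ≡-Reasoning

  rescaleM : Carrier → Monic → Monic
  rescaleM c (d , π) = d , rescaleMonic c π

  rescaleM-inverse : ∀ u π → rescaleM (inv u) (rescaleM (val u) π) ≡ π
  rescaleM-inverse u (d , π) = cong (d ,_) (rescaleMonic-inverse u π)

  rescaleM-injective : ∀ u {π π′} → rescaleM (val u) π ≡ rescaleM (val u) π′ → π ≡ π′
  rescaleM-injective u {π} {π′} eq = begin
    π                                      ≡⟨ sym (rescaleM-inverse u π) ⟩
    rescaleM (inv u) (rescaleM (val u) π)  ≡⟨ cong (rescaleM (inv u)) eq ⟩
    rescaleM (inv u) (rescaleM (val u) π′) ≡⟨ rescaleM-inverse u π′ ⟩
    π′                                     ∎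

  -- A factorization of the rescaled π rescales back (by u⁻¹) to one of π.
  irreducible-rescale : ∀ u π → Irreducible π → Irreducible (rescaleM (val u) π)
  irreducible-rescale u (d , π) (d≥1 , noFactorization) = d≥1 , λ where
    (a , b , a≥1 , b≥1 , g , h , gh≡π′) →
      noFactorization (a , b , a≥1 , b≥1 , rescaleMonic (inv u) g , rescaleMonic (inv u) h , (begin
        toPoly (rescaleMonic (inv u) g) *ₚ toPoly (rescaleMonic (inv u) h)
          ≡⟨ sym (cong₂ _*ₚ_ (rescale-toPoly (u ⁻¹ᵘ) g) (rescale-toPoly (u ⁻¹ᵘ) h)) ⟩
        rescale (u ⁻¹ᵘ) (toPoly g) *ₚ rescale (u ⁻¹ᵘ) (toPoly h)
          ≡⟨ sym (rescale-*ₚ (u ⁻¹ᵘ) (toPoly-nonEmpty g) (toPoly-nonEmpty h)) ⟩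
        rescale (u ⁻¹ᵘ) (toPoly g *ₚ toPoly h)
          ≡⟨ cong (rescale (u ⁻¹ᵘ)) gh≡π′ ⟩
        rescale (u ⁻¹ᵘ) (toPoly (rescaleMonic (val u) π))
          ≡⟨ rescale-toPoly (u ⁻¹ᵘ) (rescaleMonic (val u) π) ⟩
        toPoly (rescaleMonic (inv u) (rescaleMonic (val u) π))
          ≡⟨ cong toPoly (rescaleMonic-inverse u π) ⟩
        toPoly π ∎))

  factorPolys : List Monic → List Poly
  factorPolys = List.map (λ π → toPoly (proj₂ π))

  factorPolys-rescale : ∀ u πs →
    factorPolys (List.map (rescaleM (val u)) πs) ≡ List.map (rescale u) (factorPolys πs)
  factorPolys-rescale u []            = refl
  factorPolys-rescale u ((d , π) ∷ πs) =
    cong₂ _∷_ (sym (rescale-toPoly u π)) (factorPolys-rescale u πs)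

  -- Rescaled factors (same degrees, irreducible, distinct) factor the
  -- rescaled polynomial, by multiplicativity of rescaling.
  hasType-rescale : ∀ u {m} (λs : List ℕ) (f : Vec Carrier m) →
    HasFactorizationType λs f → HasFactorizationType λs (rescaleMonic (val u) f)
  hasType-rescale u λs f (πs , degrees , irreducible , distinct , product) =
    List.map (rescaleM (val u)) πs ,
    trans (sym (LP.map-∘ πs)) degrees ,
    AllP.map⁺ (All.map (λ {π} → irreducible-rescale u π) irreducible) ,
    UP.map⁺ (rescaleM-injective u) distinct ,
    (begin
      prodₚ (factorPolys (List.map (rescaleM (val u)) πs))
        ≡⟨ cong prodₚ (factorPolys-rescale u πs) ⟩
      prodₚ (List.map (rescale u) (factorPolys πs))
        ≡⟨ sym (rescale-prodₚ u (AllP.map⁺ (All.universal (toPoly-nonEmpty ∘ proj₂) πs))) ⟩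
      rescale u (prodₚ (factorPolys πs))
        ≡⟨ cong (rescale u) product ⟩
      rescale u (toPoly f)
        ≡⟨ rescale-toPoly u f ⟩
      toPoly (rescaleMonic (val u) f) ∎)

module ScaledRoots (L : Field) where
  open Field L
  open FieldAlgebra L
  open Rescaling L
  open ≡-Reasoning

  rescale-linear : ∀ u a → rescale u ((- a) ∷ 1# ∷ []) ≡ (- (val u * a)) ∷ 1# ∷ []
  rescale-linear u a = cong₂ (λ x y → x ∷ y ∷ [])
    (trans (cong (_* (- a)) (*-identityʳ (val u))) (sym (-‿distribʳ-* (val u) a)))
    (trans (cong₂ _*_ (*-identityʳ (val u)) (*-identityʳ (inv u))) (val*inv u))

  linearProd-scale : ∀ u αs → linearProd L (List.map (val u *_) αs) ≡ rescale u (linearProd L αs)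
  linearProd-scale u αs = begin
    prodₚ (List.map linear (List.map (val u *_) αs))
      ≡⟨ cong prodₚ (sym (LP.map-∘ αs)) ⟩
    prodₚ (List.map (linear ∘ (val u *_)) αs)
      ≡⟨ cong prodₚ (LP.map-cong (λ a → sym (rescale-linear u a)) αs) ⟩
    prodₚ (List.map (rescale u ∘ linear) αs)
      ≡⟨ cong prodₚ (LP.map-∘ αs) ⟩
    prodₚ (List.map (rescale u) (List.map linear αs))
      ≡⟨ sym (rescale-prodₚ u (AllP.map⁺ (All.universal (λ _ → nonEmpty) αs))) ⟩
    rescale u (prodₚ (List.map linear αs)) ∎
    where
    linear : Carrier → Poly
    linear a = (- a) ∷ 1# ∷ []

  squaredDifferences : Carrier → List Carrier → Carrier
  squaredDifferences a = foldr (λ b r → ((a - b) ^ 2) * r) 1#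

  squaredDifferences-scale : ∀ v a bs →
    squaredDifferences (v * a) (List.map (v *_) bs) ≡ v ^ (length bs ℕ.+ length bs) * squaredDifferences a bs
  squaredDifferences-scale v a []       = sym (*-identityˡ 1#)
  squaredDifferences-scale v a (b ∷ bs) = begin
    (((v * a) - (v * b)) ^ 2) * squaredDifferences (v * a) (List.map (v *_) bs)
      ≡⟨ cong₂ (λ t r → (t ^ 2) * r) (sym (x[y-z]≈xy-xz v a b)) (squaredDifferences-scale v a bs) ⟩
    ((v * (a - b)) ^ 2) * (v ^ (k ℕ.+ k) * D)
      ≡⟨ cong (_* (v ^ (k ℕ.+ k) * D)) (*-^ v (a - b) 2) ⟩
    (v ^ 2 * (a - b) ^ 2) * (v ^ (k ℕ.+ k) * D)
      ≡⟨ interchange (v ^ 2) ((a - b) ^ 2) (v ^ (k ℕ.+ k)) D ⟩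
    (v ^ 2 * v ^ (k ℕ.+ k)) * ((a - b) ^ 2 * D)
      ≡⟨ cong (_* ((a - b) ^ 2 * D)) (sym (^-+ v 2 (k ℕ.+ k))) ⟩
    v ^ (2 ℕ.+ (k ℕ.+ k)) * ((a - b) ^ 2 * D)
      ≡⟨ cong (λ n → v ^ suc n * ((a - b) ^ 2 * D)) (sym (ℕP.+-suc k k)) ⟩
    v ^ (suc k ℕ.+ suc k) * ((a - b) ^ 2 * D) ∎
    where
    k : ℕ
    k = length bs
    D : Carrier
    D = squaredDifferences a bs

  -- (k+1)k = 2k + k(k-1): the pairs among k+1 roots.
  pairs-step : ∀ k → suc k ℕ.* k ≡ (k ℕ.+ k) ℕ.+ k ℕ.* (k ∸ 1)
  pairs-step zero    = refl
  pairs-step (suc j) = expanded j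
    where
    expanded : ∀ j → suc (suc j) ℕ.* suc j ≡ (suc j ℕ.+ suc j) ℕ.+ suc j ℕ.* j
    expanded = solve-∀

  rootDiscProd-scale : ∀ v αs →
    rootDiscProd L (List.map (v *_) αs) ≡ v ^ (length αs ℕ.* (length αs ∸ 1)) * rootDiscProd L αs
  rootDiscProd-scale v []       = sym (*-identityˡ 1#)
  rootDiscProd-scale v (a ∷ αs) = begin
    squaredDifferences (v * a) (List.map (v *_) αs) * rootDiscProd L (List.map (v *_) αs)
      ≡⟨ cong₂ _*_ (squaredDifferences-scale v a αs) (rootDiscProd-scale v αs) ⟩
    (v ^ (k ℕ.+ k) * D) * (v ^ (k ℕ.* (k ∸ 1)) * R)
      ≡⟨ interchange (v ^ (k ℕ.+ k)) D (v ^ (k ℕ.* (k ∸ 1))) R ⟩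
    (v ^ (k ℕ.+ k) * v ^ (k ℕ.* (k ∸ 1))) * (D * R)
      ≡⟨ cong (_* (D * R)) (sym (^-+ v (k ℕ.+ k) (k ℕ.* (k ∸ 1)))) ⟩
    v ^ ((k ℕ.+ k) ℕ.+ k ℕ.* (k ∸ 1)) * (D * R)
      ≡⟨ cong (λ n → v ^ n * (D * R)) (sym (pairs-step k)) ⟩
    v ^ (suc k ℕ.* k) * (D * R) ∎
    where
    k : ℕ
    k = length αs
    D R : Carrier
    D = squaredDifferences a αs
    R = rootDiscProd L αs

module Transport (K L : Field) (φ : Field.Carrier K → Field.Carrier L) (hom : IsFieldHom K L φ) where
  private
    module K = Field K
    module L = Field L
    module AK = FieldAlgebra K
    module AL = FieldAlgebra L
    module RK = Rescaling K
    module RL = Rescaling L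
  open IsFieldHom hom
  open ≡-Reasoning

  φ-^ : ∀ x n → φ (x K.^ n) ≡ φ x L.^ n
  φ-^ x zero    = 1-homo
  φ-^ x (suc n) = trans (*-homo x (x K.^ n)) (cong (φ x L.*_) (φ-^ x n))

  φᵘ : AK.Unit → AL.Unit
  φᵘ u = record
    { val = φ (AK.val u) ; inv = φ (AK.inv u)
    ; val*inv = trans (sym (*-homo _ _)) (trans (cong φ (AK.val*inv u)) 1-homo) }

  φ-⊙ : ∀ c p → List.map φ (c RK.⊙ p) ≡ φ c RL.⊙ List.map φ p
  φ-⊙ c []      = refl
  φ-⊙ c (a ∷ p) = cong₂ _∷_ (*-homo c a) (φ-⊙ c p)

  φ-σ : ∀ w p → List.map φ (RK.σ w p) ≡ RL.σ (φ w) (List.map φ p)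
  φ-σ w []      = refl
  φ-σ w (a ∷ p) = cong (φ a ∷_) (trans (φ-⊙ w (RK.σ w p)) (cong (φ w RL.⊙_) (φ-σ w p)))

  φ-rescale : ∀ u p → List.map φ (RK.rescale u p) ≡ RL.rescale (φᵘ u) (List.map φ p)
  φ-rescale u p = begin
    List.map φ ((AK.val u K.^ (length p ∸ 1)) RK.⊙ RK.σ (AK.inv u) p)
      ≡⟨ φ-⊙ _ (RK.σ (AK.inv u) p) ⟩
    φ (AK.val u K.^ (length p ∸ 1)) RL.⊙ List.map φ (RK.σ (AK.inv u) p)
      ≡⟨ cong₂ RL._⊙_ (φ-^ (AK.val u) (length p ∸ 1)) (φ-σ (AK.inv u) p) ⟩
    (φ (AK.val u) L.^ (length p ∸ 1)) RL.⊙ RL.σ (φ (AK.inv u)) (List.map φ p)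
      ≡⟨ cong (λ n → (φ (AK.val u) L.^ (n ∸ 1)) RL.⊙ RL.σ (φ (AK.inv u)) (List.map φ p))
              (sym (LP.length-map φ p)) ⟩
    RL.rescale (φᵘ u) (List.map φ p) ∎

-- Discriminant of the rescaled polynomial: if f has roots αᵢ (in a
-- splitting field L) then u^m f(x/u) has roots u·αᵢ, so its discriminant
-- is u^(m(m-1)) disc f.
disc-rescale : (K : Field) (u : FieldAlgebra.Unit K) → ∀ {m} (f : Vec (Field.Carrier K) m) δ →
  IsDisc K f δ →
  IsDisc K (Rescaling.rescaleMonic K (FieldAlgebra.val u) f)
           (Field._*_ K (Field._^_ K (FieldAlgebra.val u) (m ℕ.* (m ∸ 1))) δ)
disc-rescale K u {m} f δ (L , φ , hom , αs , splits , disc) =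
  L , φ , hom , Vec.map (v′ L.*_) αs , splits′ , disc′
  where
  module K = Field K
  module L = Field L
  open FieldAlgebra K using (val)
  open Rescaling using (rescale; rescale-toPoly)
  open ScaledRoots L using (linearProd-scale; rootDiscProd-scale)
  open Transport K L φ hom using (φᵘ; φ-rescale; φ-^)
  open IsFieldHom hom using (*-homo)
  open ≡-Reasoning
  v′ : L.Carrier
  v′ = φ (val u)
  roots : List L.Carrier
  roots = Vec.toList αs
  M : ℕ
  M = m ℕ.* (m ∸ 1)

  splits′ : List.map φ (K.toPoly (Rescaling.rescaleMonic K (val u) f))
            ≡ linearProd L (Vec.toList (Vec.map (v′ L.*_) αs))
  splits′ = begin
    List.map φ (K.toPoly (Rescaling.rescaleMonic K (val u) f))
      ≡⟨ cong (List.map φ) (sym (rescale-toPoly K u f)) ⟩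
    List.map φ (rescale K u (K.toPoly f))             ≡⟨ φ-rescale u (K.toPoly f) ⟩
    rescale L (φᵘ u) (List.map φ (K.toPoly f))        ≡⟨ cong (rescale L (φᵘ u)) splits ⟩
    rescale L (φᵘ u) (linearProd L roots)             ≡⟨ sym (linearProd-scale (φᵘ u) roots) ⟩
    linearProd L (List.map (v′ L.*_) roots)           ≡⟨ cong (linearProd L) (sym (VP.toList-map (v′ L.*_) αs)) ⟩
    linearProd L (Vec.toList (Vec.map (v′ L.*_) αs))  ∎

  disc′ : φ ((val u K.^ M) K.* δ) ≡ rootDiscProd L (Vec.toList (Vec.map (v′ L.*_) αs))
  disc′ = begin
    φ ((val u K.^ M) K.* δ)                         ≡⟨ *-homo _ δ ⟩
    φ (val u K.^ M) L.* φ δ                         ≡⟨ cong₂ L._*_ (φ-^ (val u) M) disc ⟩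
    (v′ L.^ M) L.* rootDiscProd L roots
      ≡⟨ cong (λ n → (v′ L.^ (n ℕ.* (n ∸ 1))) L.* rootDiscProd L roots) (sym (VP.length-toList αs)) ⟩
    (v′ L.^ (length roots ℕ.* (length roots ∸ 1))) L.* rootDiscProd L roots
      ≡⟨ sym (rootDiscProd-scale v′ roots) ⟩
    rootDiscProd L (List.map (v′ L.*_) roots)       ≡⟨ cong (rootDiscProd L) (sym (VP.toList-map (v′ L.*_) αs)) ⟩
    rootDiscProd L (Vec.toList (Vec.map (v′ L.*_) αs)) ∎

hasCount-bijection : ∀ {A B : Set} {P : A → Set₁} {Q : B → Set₁} (f : A → B) (g : B → A) →
  (∀ x → g (f x) ≡ x) → (∀ y → f (g y) ≡ y) →
  (∀ {x} → P x → Q (f x)) → (∀ {y} → Q y → P (g y)) →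
  ∀ {n} → HasCount P n → HasCount Q n
hasCount-bijection {P = P} {Q} f g g∘f f∘g P⇒Q Q⇒P (l , len , distinct , members) =
  List.map f l , trans (LP.length-map f l) len , UP.map⁺ f-injective distinct ,
  λ y → image⇒Q y , Q⇒image y
  where
  f-injective : ∀ {x x′} → f x ≡ f x′ → x ≡ x′
  f-injective {x} {x′} eq = trans (sym (g∘f x)) (trans (cong g eq) (g∘f x′))
  image⇒Q : ∀ y → y ∈ List.map f l → Q y
  image⇒Q y y∈ with x , x∈l , refl ← MP.∈-map⁻ f y∈ = P⇒Q (proj₁ (members x) x∈l)
  Q⇒image : ∀ y → Q y → y ∈ List.map f l
  Q⇒image y q = subst (_∈ List.map f l) (f∘g y) (MP.∈-map⁺ f (proj₂ (members (g y)) (Q⇒P q)))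

module Counting (K : Field) (m : ℕ) (λs : List ℕ) where
  open Field K
  open FieldAlgebra K
  open Rescaling K using (rescaleMonic; rescaleMonic-inverse)
  open FactorizationType K using (hasType-rescale)

  M : ℕ
  M = m ℕ.* (m ∸ 1)

  inS-rescale : ∀ u {δ f} → InSWithDisc K m λs δ f → InSWithDisc K m λs (val u ^ M * δ) (rescaleMonic (val u) f)
  inS-rescale u {δ} {f} (lift hasType , isDisc) = lift (hasType-rescale u λs f hasType) , disc-rescale K u f δ isDisc

  count-rescale : ∀ u {δ δ′} → δ′ ≡ val u ^ M * δ → ∀ {n} →
    HasCount (InSWithDisc K m λs δ) n → HasCount (InSWithDisc K m λs δ′) n
  count-rescale u {δ} {δ′} δ′≡ =
    hasCount-bijection (rescaleMonic (val u)) (rescaleMonic (inv u))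
      (rescaleMonic-inverse u) (rescaleMonic-inverse (u ⁻¹ᵘ))
      (λ inS → subst (λ d → InSWithDisc K m λs d _) (sym δ′≡) (inS-rescale u inS))
      (λ inS → subst (λ d → InSWithDisc K m λs d _) δ≡ (inS-rescale (u ⁻¹ᵘ) inS))
    where
    δ≡ : inv u ^ M * δ′ ≡ δ
    δ≡ = trans (cong (inv u ^ M *_) δ′≡) (inv-cancel (u ^ᵘ M) δ)

-- In a finite field with q elements every nonzero c satisfies c^(q-1) = 1,
-- hence c^gcd(q-1, M) is an M-th power of a unit, by Bézout.
module FiniteFieldPowers (F : FiniteField) where
  open FiniteField F
  open Field field′
  open FieldAlgebra field′
  open ≡-Reasoning
  module PS = Data.List.Relation.Binary.Permutation.Setoid.Properties (setoid Carrier)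

  private
    zeroFirst : Σ (List Carrier) λ N → elements ↭ 0# ∷ N
    zeroFirst with ys , zs , eq ← MP.∈-∃++ (complete 0#) =
      ys List.++ zs , subst (_↭ 0# ∷ ys List.++ zs) (sym eq) (PP.shift 0# ys zs)

  nonzeros : List Carrier
  nonzeros = proj₁ zeroFirst

  elements↭ : elements ↭ 0# ∷ nonzeros
  elements↭ = proj₂ zeroFirst

  nonzeros-length : size ∸ 1 ≡ length nonzeros
  nonzeros-length = cong (_∸ 1) (PP.↭-length elements↭)

  private
    unique-zeroFirst : Unique (0# ∷ nonzeros)
    unique-zeroFirst = PS.Unique-resp-↭ (↭⇒↭ₛ elements↭) distinct

  nonzeros-unique : Unique nonzeros
  nonzeros-unique with _ ∷ u ← unique-zeroFirst = u

  nonzeros-nonzero : ∀ {x} → x ∈ nonzeros → x ≢ 0#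
  nonzeros-nonzero x∈ with 0≢ ∷ _ ← unique-zeroFirst = λ x≡0 → All.lookup 0≢ x∈ (sym x≡0)

  nonzeros-complete : ∀ {x} → x ≢ 0# → x ∈ nonzeros
  nonzeros-complete {x} x≢0 with PP.∈-resp-↭ elements↭ (complete x)
  ... | here x≡0 = ⊥-elim (x≢0 x≡0)
  ... | there x∈ = x∈

  product : List Carrier → Carrier
  product = foldr _*_ 1#

  product-nonzero : ∀ {xs} → All (_≢ 0#) xs → product xs ≢ 0#
  product-nonzero []           = λ 1≡0 → 0≢1 (sym 1≡0)
  product-nonzero (x≢0 ∷ xs≢0) = nonzero-* x≢0 (product-nonzero xs≢0)

  product-scale : ∀ c xs → product (List.map (c *_) xs) ≡ c ^ length xs * product xs
  product-scale c []       = sym (*-identityˡ 1#)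
  product-scale c (x ∷ xs) =
    trans (cong ((c * x) *_) (product-scale c xs)) (interchange c x (c ^ length xs) (product xs))

  scale-permutes : ∀ c → c ≢ 0# → List.map (c *_) nonzeros ↭ nonzeros
  scale-permutes c c≢0 = ∼bag⇒↭ (unique∧set⇒bag
    (UP.map⁺ c-injective nonzeros-unique) nonzeros-unique (mk⇔ into onto))
    where
    cᵘ : Unit
    cᵘ = unitOf c c≢0
    c-injective : ∀ {x y} → c * x ≡ c * y → x ≡ y
    c-injective {x} {y} eq =
      trans (sym (inv-cancel cᵘ x)) (trans (cong (inv cᵘ *_) eq) (inv-cancel cᵘ y))
    into : ∀ {y} → y ∈ List.map (c *_) nonzeros → y ∈ nonzeros
    into y∈ with x , x∈ , refl ← MP.∈-map⁻ (c *_) y∈ =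
      nonzeros-complete (nonzero-* c≢0 (nonzeros-nonzero x∈))
    onto : ∀ {y} → y ∈ nonzeros → y ∈ List.map (c *_) nonzeros
    onto {y} y∈ = subst (_∈ List.map (c *_) nonzeros) (inv-cancel (cᵘ ⁻¹ᵘ) y)
      (MP.∈-map⁺ (c *_) (nonzeros-complete (λ c⁻¹y≡0 → nonzeros-nonzero y∈
        (trans (sym (inv-cancel (cᵘ ⁻¹ᵘ) y)) (trans (cong (c *_) c⁻¹y≡0) (zeroʳ c))))))

  -- Fermat's little theorem: c^(q-1) = 1 for c ≠ 0, comparing the products
  -- of the nonzero elements before and after multiplying them by c.
  fermat : ∀ c → c ≢ 0# → c ^ (size ∸ 1) ≡ 1#
  fermat c c≢0 = subst (λ n → c ^ n ≡ 1#) (sym nonzeros-length)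
    (cancel-nonzero (product-nonzero (All.tabulate nonzeros-nonzero)) (begin
      c ^ length nonzeros * product nonzeros ≡⟨ sym (product-scale c nonzeros) ⟩
      product (List.map (c *_) nonzeros)     ≡⟨ PS.foldr-commMonoid *-isCommutativeMonoid
                                                   (↭⇒↭ₛ (scale-permutes c c≢0)) ⟩
      product nonzeros                       ∎))

  fermat-multiple : ∀ {c} → c ≢ 0# → ∀ x → c ^ (x ℕ.* (size ∸ 1)) ≡ 1#
  fermat-multiple {c} c≢0 x = trans (^-* c x (size ∸ 1)) (trans (cong (_^ x) (fermat c c≢0)) (1^ x))

  gcd-power-is-power : ∀ M c → c ≢ 0# → Σ Unit λ u → c ^ gcd (size ∸ 1) M ≡ val u ^ M
  gcd-power-is-power M c c≢0 with Bézout.identity (gcd-GCD (size ∸ 1) M)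
  ... | Bézout.-+ x y g+x[q-1]≡yM = cᵘ ^ᵘ y , (begin
    c ^ g                                   ≡⟨ sym (*-identityʳ _) ⟩
    c ^ g * 1#                              ≡⟨ cong (c ^ g *_) (sym (fermat-multiple c≢0 x)) ⟩
    c ^ g * c ^ (x ℕ.* (size ∸ 1))          ≡⟨ sym (^-+ c g _) ⟩
    c ^ (g ℕ.+ x ℕ.* (size ∸ 1))            ≡⟨ cong (c ^_) (trans g+x[q-1]≡yM (ℕP.*-comm y M)) ⟩
    c ^ (M ℕ.* y)                           ≡⟨ ^-* c M y ⟩
    (c ^ y) ^ M                             ∎)
    where
    g : ℕ
    g = gcd (size ∸ 1) M
    cᵘ : Unit
    cᵘ = unitOf c c≢0
  ... | Bézout.+- x y g+yM≡x[q-1] = cʸ ⁻¹ᵘ , (begin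
    c ^ g                                   ≡⟨ sym (inv-cancel (cʸ ^ᵘ M) (c ^ g)) ⟩
    inv cʸ ^ M * ((c ^ y) ^ M * c ^ g)    ≡⟨ cong (inv cʸ ^ M *_) (begin
        (c ^ y) ^ M * c ^ g                 ≡⟨ cong (_* c ^ g) (sym (^-* c M y)) ⟩
        c ^ (M ℕ.* y) * c ^ g               ≡⟨ *-comm _ (c ^ g) ⟩
        c ^ g * c ^ (M ℕ.* y)               ≡⟨ sym (^-+ c g _) ⟩
        c ^ (g ℕ.+ M ℕ.* y)                 ≡⟨ cong (c ^_) (trans (cong (g ℕ.+_) (ℕP.*-comm M y)) g+yM≡x[q-1]) ⟩
        c ^ (x ℕ.* (size ∸ 1))              ≡⟨ fermat-multiple c≢0 x ⟩
        1#                                  ∎) ⟩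
    inv cʸ ^ M * 1#                        ≡⟨ *-identityʳ _ ⟩
    inv cʸ ^ M                             ∎)
    where
    g : ℕ
    g = gcd (size ∸ 1) M
    cʸ : Unit
    cʸ = unitOf c c≢0 ^ᵘ y

open import Data.Nat using (_*_)

lemma4p3 : (F : FiniteField) → (m : ℕ) → m ≥ 2 → (λs : List ℕ) →
    IsPartition m λs →
    SNonempty (FiniteField.field′ F) m λs →
    (δ₁ δ₂ : Field.Carrier (FiniteField.field′ F)) →
    InD (FiniteField.field′ F) m λs δ₁ →
    InD (FiniteField.field′ F) m λs δ₂ →
    Σ (Field.Carrier (FiniteField.field′ F)) (λ c →
      c ≢ Field.0# (FiniteField.field′ F) ×
      δ₂ ≡ Field._*_ (FiniteField.field′ F)
             (Field._^_ (FiniteField.field′ F) c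
               (gcd (FiniteField.size F ∸ 1) (m * (m ∸ 1))))
             δ₁) →
    (n : ℕ) →
    (HasCount (InSWithDisc (FiniteField.field′ F) m λs δ₁) n →
       HasCount (InSWithDisc (FiniteField.field′ F) m λs δ₂) n) ×
    (HasCount (InSWithDisc (FiniteField.field′ F) m λs δ₂) n →
       HasCount (InSWithDisc (FiniteField.field′ F) m λs δ₁) n)
lemma4p3 F m _ λs _ _ δ₁ δ₂ _ _ (c , c≢0 , δ₂≡cᵍδ₁) n =
  count-rescale u δ₂≡uᴹδ₁ , count-rescale (u ⁻¹ᵘ) δ₁≡u⁻ᴹδ₂
  where
  K : Field
  K = FiniteField.field′ F
  open Field K using (_^_) renaming (_*_ to _*ᴷ_)
  open FieldAlgebra K using (Unit; val; inv; _⁻¹ᵘ; _^ᵘ_; inv-cancel)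
  open Counting K m λs using (M; count-rescale)
  unit-root : Σ Unit λ u → c ^ gcd (FiniteField.size F ∸ 1) M ≡ val u ^ M
  unit-root = FiniteFieldPowers.gcd-power-is-power F M c c≢0
  u : Unit
  u = proj₁ unit-root
  δ₂≡uᴹδ₁ : δ₂ ≡ (val u ^ M) *ᴷ δ₁
  δ₂≡uᴹδ₁ = trans δ₂≡cᵍδ₁ (cong (_*ᴷ δ₁) (proj₂ unit-root))
  δ₁≡u⁻ᴹδ₂ : δ₁ ≡ (inv u ^ M) *ᴷ δ₂
  δ₁≡u⁻ᴹδ₂ = sym (trans (cong ((inv u ^ M) *ᴷ_) δ₂≡uᴹδ₁) (inv-cancel (u ^ᵘ M) δ₁))
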